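{- For every integer $n\geq 1$, the empty graph $\overline{K_n}$ on $n$ vertices satisfies $\mathrm{th}_{\mathrm{H}}(\overline{K_n})=\lceil 2\sqrt{n}-1\rceil$.
   Context: All graphs are finite, simple and undirected; $N(v)$ is the open neighborhood of $v$. Vertices are colored blue or white. Under the hopping color change rule, a blue vertex $v$ may force a white vertex $w$ (not necessarily adjacent to $v$) to become blue provided $v$ has not previously performed a force and every vertex of $N(v)$ is blue. Starting from an initial blue set $B\subseteq V(G)$, a chronological list of forces is a sequence of valid forces performed one at a time until no further force is possible; its unordered set of forces is a set of forces of $B$. $B$ is a hopping forcing set if some chronological list turns every vertex blue. For a set of forces $\mathcal F$ of $B$, put $\mathcal F^{(0)}=B$ and, for $t>0$, let $\mathcal F^{(t)}$ be the set of vertices $w$ for which there is a force $v\to w$ in $\mathcal F$ with $v\in\bigcup_{i<t}\mathcal F^{(i)}$ that is a valid hopping force when exactly the vertices of $\bigcup_{i<t}\mathcal F^{(i)}$ are blue. $\mathrm{pt}_{\mathrm{H}}(G;\mathcal F)$ is the least $t$ with $\bigcup_{i\le t}\mathcal F^{(i)}=V(G)$, and $\mathrm{pt}_{\mathrm{H}}(G;B)$ is the minimum of $\mathrm{pt}_{\mathrm{H}}(G;\mathcal F)$ over sets of forces $\mathcal F$ of $B$ ($\infty$ if $B$ is not a hopping forcing set). The hopping throttling number is $\mathrm{th}_{\mathrm{H}}(G)=\min_{B\subseteq V(G)}\big(|B|+\mathrm{pt}_{\mathrm{H}}(G;B)\big)$. -}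

module Defs where

open import Level using (0ℓ)
open import Data.Nat using (ℕ; zero; suc; _+_; _*_; _≤_; _<_; _^_)
open import Data.Fin using (Fin)
open import Data.Fin.Subset using (Subset; _∈_; ∣_∣)
open import Data.Product using (Σ; ∃; ∃-syntax; _×_; _,_)
open import Data.Sum using (_⊎_)
open import Data.Empty using (⊥)
open import Data.List using (List; []; _∷_)
open import Data.List.Membership.Propositional renaming (_∈_ to _∈ₗ_)
open import Relation.Nullary using (¬_)
open import Relation.Binary.PropositionalEquality using (_≡_)

record Graph (n : ℕ) : Set₁ where
  field
    Adj     : Fin n → Fin n → Set
    symm    : ∀ {u v} → Adj u v → Adj v u
    irrefl  : ∀ {v} → ¬ Adj v v
open Graph public

emptyGraph : (n : ℕ) → Graph n
emptyGraph n = record { Adj = λ _ _ → ⊥ ; symm = λ () ; irrefl = λ () }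

VSet : ℕ → Set₁
VSet n = Fin n → Set

_∪｛_｝ : ∀ {n} → VSet n → Fin n → VSet n
(S ∪｛ w ｝) x = S x ⊎ x ≡ w

NbhdIn : ∀ {n} → Graph n → Fin n → VSet n → Set
NbhdIn G v S = ∀ u → Adj G v u → S u

-- v → w is a valid hopping force when S is blue and U is the set of
-- vertices that have already forced.
ValidForce : ∀ {n} → Graph n → VSet n → VSet n → Fin n → Fin n → Set
ValidForce G S U v w = S v × ¬ U v × ¬ S w × NbhdIn G v S

NoForce : ∀ {n} → Graph n → VSet n → VSet n → Set
NoForce G S U = ¬ (∃[ v ] ∃[ w ] ValidForce G S U v w)

data Chrono {n : ℕ} (G : Graph n) : VSet n → VSet n → List (Fin n × Fin n) → Set₁ where
  done : ∀ {S U} → NoForce G S U → Chrono G S U []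
  step : ∀ {S U v w L} → ValidForce G S U v w →
         Chrono G (S ∪｛ w ｝) (U ∪｛ v ｝) L →
         Chrono G S U ((v , w) ∷ L)

ChronoList : ∀ {n} → Graph n → Subset n → List (Fin n × Fin n) → Set₁
ChronoList G B L = Chrono G (λ x → x ∈ B) (λ _ → ⊥) L

-- Cumulative blue set  ⋃_{i ≤ t} F^(i)  for the set of forces F
-- (the elements of the list L).
Cum : ∀ {n} → Graph n → Subset n → List (Fin n × Fin n) → ℕ → VSet n
Cum G B F zero x = x ∈ B
Cum G B F (suc t) x =
  Cum G B F t x ⊎
  (∃[ v ] ((v , x) ∈ₗ F × Cum G B F t v × ¬ Cum G B F t x × NbhdIn G v (Cum G B F t)))

AllBlue : ∀ {n} → VSet n → Set
AllBlue S = ∀ x → S x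

IsPTF : ∀ {n} → Graph n → Subset n → List (Fin n × Fin n) → ℕ → Set
IsPTF G B F t = AllBlue (Cum G B F t) × (∀ s → s < t → ¬ AllBlue (Cum G B F s))

-- th_H(G) = k : k = min over B and sets of forces F of B of |B| + pt_H(G;F)
-- (equivalently min over B of |B| + pt_H(G;B)).
IsHoppingThrottlingNumber : ∀ {n} → Graph n → ℕ → Set₁
IsHoppingThrottlingNumber {n} G k =
  (∃[ B ] ∃[ F ] ∃[ t ] (ChronoList G B F × IsPTF G B F t × ∣ B ∣ + t ≡ k)) ×
  (∀ (B : Subset n) F t → ChronoList G B F → IsPTF G B F t → k ≤ ∣ B ∣ + t)

-- m = ⌈ 2√n − 1 ⌉ : m is the least natural number with m ≥ 2√n − 1,
-- i.e. the least m with 4n ≤ (m+1)^2.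
IsCeil2Sqrt-1 : ℕ → ℕ → Set
IsCeil2Sqrt-1 n m = (4 * n ≤ (m + 1) ^ 2) × (∀ k → k < m → (k + 1) ^ 2 < 4 * n)

{-# OPTIONS --safe #-}
-- Lower bound: in a chronological list every vertex forces at most once, so a vertex that is
-- blue at time t is determined by the initial vertex its forcing chain starts from and by the
-- length (at most t) of that chain.  Hence n ≤ |B|(t + 1) ≤ (|B| + t + 1)² / 4 by AM-GM, i.e.
-- |B| + t ≥ ⌈2√n − 1⌉.  Upper bound on the empty graph: split m + 1 into near-equal halves
-- b and t + 1; starting from the first b vertices, vertex i hops to vertex i + b, so after s
-- rounds exactly the first b(s + 1) vertices are blue and everything is blue at time t.  No
-- earlier time works, since that would beat the lower bound.
module Submission where

open import Defs
open import Data.Nat using (ℕ; zero; suc; _+_; _*_; _∸_; _^_; _≤_; _<_; z≤n; s≤s; z<s; _<?_)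
open import Data.Nat.Properties
open import Data.Nat.Solver using (module +-*-Solver)
open import Data.Fin as Fin using (Fin; toℕ; fromℕ<; combine)
open import Data.Fin.Properties
  using (toℕ-injective; toℕ-fromℕ<; toℕ<n; combine-injective; injective⇒≤)
  renaming (suc-injective to Fin-suc-injective)
open import Data.Fin.Subset using (Subset; inside; outside; ∣_∣)
import Data.Fin.Subset as Subset
open import Data.Fin.Subset.Properties using (∉⊥; ∣⊥∣≡0)
open import Data.Vec using ([]; _∷_; here; there)
open import Data.Product using (∃-syntax; _×_; _,_; proj₁; proj₂; swap)
open import Data.Sum using (_⊎_; inj₁; inj₂)
import Data.Sum as Sum
open import Data.Empty using (⊥-elim)
open import Data.List using (List; []; _∷_)
open import Data.List.Relation.Unary.Any using (here; there)
open import Data.List.Membership.Propositional renaming (_∈_ to _∈ₗ_)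
open import Relation.Nullary using (¬_; yes; no)
open import Relation.Unary using (_≐_)
open import Relation.Binary.PropositionalEquality

private
  variable
    n : ℕ

module _ {G : Graph n} where

  Chrono-forcerUnused : ∀ {S U L v w} → Chrono G S U L → (v , w) ∈ₗ L → ¬ U v
  Chrono-forcerUnused (step (_ , v∉U , _) _) (here refl) = v∉U
  Chrono-forcerUnused (step _ c) (there m) = λ v∈U → Chrono-forcerUnused c m (inj₁ v∈U)

  Chrono-forcesOnce : ∀ {S U L v w w′} → Chrono G S U L → (v , w) ∈ₗ L → (v , w′) ∈ₗ L → w ≡ w′
  Chrono-forcesOnce (step _ _) (here refl) (here refl) = refl
  Chrono-forcesOnce (step _ c) (here refl) (there m′) = ⊥-elim (Chrono-forcerUnused c m′ (inj₂ refl))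
  Chrono-forcesOnce (step _ c) (there m)   (here refl) = ⊥-elim (Chrono-forcerUnused c m (inj₂ refl))
  Chrono-forcesOnce (step _ c) (there m)   (there m′) = Chrono-forcesOnce c m m′

data Chain {n} (F : List (Fin n × Fin n)) (r : Fin n) : ℕ → Fin n → Set where
  []  : Chain F r 0 r
  _▷_ : ∀ {d v w} → Chain F r d v → (v , w) ∈ₗ F → Chain F r (suc d) w

Chain-functional : ∀ {F : List (Fin n × Fin n)} {r d w w′} →
  (∀ {v x x′} → (v , x) ∈ₗ F → (v , x′) ∈ₗ F → x ≡ x′) →
  Chain F r d w → Chain F r d w′ → w ≡ w′
Chain-functional once [] [] = refl
Chain-functional once (c ▷ m) (c′ ▷ m′) with refl ← Chain-functional once c c′ = once m m′

Cum⇒Chain : ∀ {G : Graph n} {B F} t {x} → Cum G B F t x →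
  ∃[ r ] (r Subset.∈ B × ∃[ d ] (d ≤ t × Chain F r d x))
Cum⇒Chain zero x∈B = _ , x∈B , 0 , z≤n , []
Cum⇒Chain (suc t) (inj₁ c) with Cum⇒Chain t c
... | r , r∈B , d , d≤t , chain = r , r∈B , d , m≤n⇒m≤1+n d≤t , chain
Cum⇒Chain (suc t) (inj₂ (v , m , c , _)) with Cum⇒Chain t c
... | r , r∈B , d , d≤t , chain = r , r∈B , suc d , s≤s d≤t , chain ▷ m

rank : (p : Subset n) {x : Fin n} → x Subset.∈ p → Fin ∣ p ∣
rank (inside  ∷ p) here      = Fin.zero
rank (inside  ∷ p) (there h) = Fin.suc (rank p h)
rank (outside ∷ p) (there h) = rank p h

rank-injective : (p : Subset n) {x y : Fin n} (x∈p : x Subset.∈ p) (y∈p : y Subset.∈ p) →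
  rank p x∈p ≡ rank p y∈p → x ≡ y
rank-injective (inside  ∷ p) here       here       _ = refl
rank-injective (inside  ∷ p) (there x∈) (there y∈) e =
  cong Fin.suc (rank-injective p x∈ y∈ (Fin-suc-injective e))
rank-injective (outside ∷ p) (there x∈) (there y∈) e = cong Fin.suc (rank-injective p x∈ y∈ e)

allBlue⇒n≤∣B∣*[1+t] : ∀ {G : Graph n} {B F} t → ChronoList G B F → AllBlue (Cum G B F t) →
  n ≤ ∣ B ∣ * suc t
allBlue⇒n≤∣B∣*[1+t] {n = n} {B = B} t chrono allBlue = injective⇒≤ label-injective
  where
  label : Fin n → Fin (∣ B ∣ * suc t)
  label x with Cum⇒Chain t (allBlue x)
  ... | _ , r∈B , _ , d≤t , _ = combine (rank B r∈B) (fromℕ< (s≤s d≤t))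

  label-injective : ∀ {x y} → label x ≡ label y → x ≡ y
  label-injective {x} {y} e with Cum⇒Chain t (allBlue x) | Cum⇒Chain t (allBlue y)
  ... | _ , r∈B , _ , d≤t , chain | _ , r′∈B , _ , d′≤t , chain′
    with combine-injective (rank B r∈B) _ (rank B r′∈B) _ e
  ... | same-rank , same-length
    with refl ← rank-injective B r∈B r′∈B same-rank
    with refl ← trans (sym (toℕ-fromℕ< (s≤s d≤t)))
                      (trans (cong toℕ same-length) (toℕ-fromℕ< (s≤s d′≤t)))
    = Chain-functional (Chrono-forcesOnce chrono) chain chain′

module _ where
  open +-*-Solver

  [2a+k]²≡4a[a+k]+k² : ∀ a k → (a + (a + k)) ^ 2 ≡ 4 * (a * (a + k)) + k * k
  [2a+k]²≡4a[a+k]+k² = solve 2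
    (λ a k → (a :+ (a :+ k)) :^ 2 := con 4 :* (a :* (a :+ k)) :+ k :* k) refl

  [2t+2]²≡4[t+1][t+1] : ∀ t → (suc (t + t) + 1) ^ 2 ≡ 4 * (suc t * suc t)
  [2t+2]²≡4[t+1][t+1] = solve 1
    (λ t → (con 1 :+ (t :+ t) :+ con 1) :^ 2 := con 4 :* ((con 1 :+ t) :* (con 1 :+ t))) refl

  [2t+3]²≡4[t+2][t+1]+1 : ∀ t → (suc (suc (t + t)) + 1) ^ 2 ≡ 4 * (suc (suc t) * suc t) + 1
  [2t+3]²≡4[t+2][t+1]+1 = solve 1
    (λ t → (con 2 :+ (t :+ t) :+ con 1) :^ 2 := con 4 :* ((con 2 :+ t) :* (con 1 :+ t)) :+ con 1) refl

4ac≤[a+c]² : ∀ a c → 4 * (a * c) ≤ (a + c) ^ 2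
4ac≤[a+c]² a c = Sum.[ ordered , swapped ]′ (≤-total a c)
  where
  ordered : ∀ {x y} → x ≤ y → 4 * (x * y) ≤ (x + y) ^ 2
  ordered {x} x≤y with k , refl ← m≤n⇒∃[o]m+o≡n x≤y =
    subst (4 * (x * (x + k)) ≤_) (sym ([2a+k]²≡4a[a+k]+k² x k)) (m≤m+n (4 * (x * (x + k))) (k * k))

  swapped : c ≤ a → 4 * (a * c) ≤ (a + c) ^ 2
  swapped c≤a = subst₂ _≤_ (cong (4 *_) (*-comm c a)) (cong (_^ 2) (+-comm c a)) (ordered c≤a)

4n≤4x+1⇒n≤x : ∀ {n x} → 4 * n ≤ 4 * x + 1 → n ≤ x
4n≤4x+1⇒n≤x {n} {x} 4n≤4x+1 = ≮⇒≥ λ x<n → <⇒≱ (<-≤-trans 4x+1<4[x+1] (*-monoʳ-≤ 4 x<n)) 4n≤4x+1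
  where
  4x+1<4[x+1] : 4 * x + 1 < 4 * suc x
  4x+1<4[x+1] = subst (4 * x + 1 <_) (trans (+-comm (4 * x) 4) (sym (*-suc 4 x)))
                      (+-monoʳ-< (4 * x) (s≤s (s≤s z≤n)))

even⊎odd : ∀ k → ∃[ t ] (k ≡ t + t ⊎ k ≡ suc (t + t))
even⊎odd zero = 0 , inj₁ refl
even⊎odd (suc k) with even⊎odd k
... | t , inj₁ refl = t , inj₂ refl
... | t , inj₂ refl = suc t , inj₁ (cong suc (sym (+-suc t t)))

IsCeil2Sqrt-1⇒≤ : ∀ {n m} → IsCeil2Sqrt-1 n m → ∀ a t → n ≤ a * suc t → m ≤ a + t
IsCeil2Sqrt-1⇒≤ {n} (_ , below) a t n≤a[t+1] = ≮⇒≥ λ a+t<m → <⇒≱ (below (a + t) a+t<m) (begin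
  4 * n              ≤⟨ *-monoʳ-≤ 4 n≤a[t+1] ⟩
  4 * (a * suc t)    ≤⟨ 4ac≤[a+c]² a (suc t) ⟩
  (a + suc t) ^ 2    ≡⟨ cong (_^ 2) (trans (+-suc a t) (+-comm 1 (a + t))) ⟩
  (a + t + 1) ^ 2    ∎)
  where open ≤-Reasoning

IsCeil2Sqrt-1⇒split : ∀ {n m} → 1 ≤ n → IsCeil2Sqrt-1 n m →
  ∃[ b ] ∃[ t ] (1 ≤ b × n ≤ b * suc t × b + t ≡ m)
IsCeil2Sqrt-1⇒split {m = zero} 1≤n (4n≤1 , _) = ⊥-elim (<⇒≱ 1≤n (4n≤4x+1⇒n≤x 4n≤1))
IsCeil2Sqrt-1⇒split {n} {suc k} 1≤n (4n≤[m+1]² , _) with even⊎odd k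
... | t , inj₁ refl = suc t , t , s≤s z≤n ,
  *-cancelˡ-≤ 4 (subst (4 * n ≤_) ([2t+2]²≡4[t+1][t+1] t) 4n≤[m+1]²) , refl
... | t , inj₂ refl = suc (suc t) , t , s≤s z≤n ,
  4n≤4x+1⇒n≤x (subst (4 * n ≤_) ([2t+3]²≡4[t+2][t+1]+1 t) 4n≤[m+1]²) , refl

IsHoppingThrottlingNumber-intro : ∀ {G : Graph n} {m} →
  (∀ B F t → ChronoList G B F → AllBlue (Cum G B F t) → m ≤ ∣ B ∣ + t) →
  ∃[ B ] ∃[ F ] ∃[ t ] (ChronoList G B F × AllBlue (Cum G B F t) × ∣ B ∣ + t ≤ m) →
  IsHoppingThrottlingNumber G m
IsHoppingThrottlingNumber-intro {G = G} lower (B , F , t , chrono , allBlue , ∣B∣+t≤m) =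
  (B , F , t , chrono , (allBlue , earlier-not-allBlue) ,
   ≤-antisym ∣B∣+t≤m (lower B F t chrono allBlue)) ,
  λ B′ F′ t′ chrono′ (allBlue′ , _) → lower B′ F′ t′ chrono′ allBlue′
  where
  earlier-not-allBlue : ∀ s → s < t → ¬ AllBlue (Cum G B F s)
  earlier-not-allBlue s s<t allBlue-s =
    <⇒≱ (+-monoʳ-< ∣ B ∣ s<t) (≤-trans ∣B∣+t≤m (lower B F s chrono allBlue-s))

module _ {G : Graph n} where

  ∪｛｝-resp-≐ : ∀ {S S′ : VSet n} {w} → S ≐ S′ → (S ∪｛ w ｝) ≐ (S′ ∪｛ w ｝)
  ∪｛｝-resp-≐ (S⊆S′ , S′⊆S) = Sum.map₁ S⊆S′ , Sum.map₁ S′⊆S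

  ValidForce-resp-≐ : ∀ {S S′ U U′ : VSet n} {v w} → S ≐ S′ → U ≐ U′ →
    ValidForce G S U v w → ValidForce G S′ U′ v w
  ValidForce-resp-≐ (S⊆S′ , S′⊆S) (_ , U′⊆U) (v∈S , v∉U , w∉S , N[v]⊆S) =
    S⊆S′ v∈S , (λ v∈U′ → v∉U (U′⊆U v∈U′)) , (λ w∈S′ → w∉S (S′⊆S w∈S′)) ,
    λ u adj → S⊆S′ (N[v]⊆S u adj)

  Chrono-resp-≐ : ∀ {S S′ U U′ : VSet n} {L} → S ≐ S′ → U ≐ U′ → Chrono G S U L → Chrono G S′ U′ L
  Chrono-resp-≐ S≐S′ U≐U′ (done noForce) =
    done λ (v , w , force) → noForce (v , w , ValidForce-resp-≐ (swap S≐S′) (swap U≐U′) force)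
  Chrono-resp-≐ S≐S′ U≐U′ (step force chrono) =
    step (ValidForce-resp-≐ S≐S′ U≐U′ force)
         (Chrono-resp-≐ (∪｛｝-resp-≐ S≐S′) (∪｛｝-resp-≐ U≐U′) chrono)

Below : ℕ → VSet n
Below k x = toℕ x < k

Below-suc : ∀ {k} {x : Fin n} → toℕ x ≡ k → Below (suc k) ≐ (Below k ∪｛ x ｝)
Below-suc {x = x} refl =
  (λ {y} y<1+k → Sum.map₂ (toℕ-injective {i = y} {j = x}) (m<1+n⇒m<n∨m≡n y<1+k)) ,
  Sum.[ m<n⇒m<1+n , (λ { refl → ≤-refl }) ]′

initialSegment : ∀ n → ℕ → Subset n
initialSegment zero    _       = []
initialSegment (suc n) zero    = Subset.⊥
initialSegment (suc n) (suc b) = inside ∷ initialSegment n b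

∈initialSegment≐Below : ∀ n b → (λ x → x Subset.∈ initialSegment n b) ≐ Below b
∈initialSegment≐Below n b = ⊆ n b , ⊇ n b
  where
  ⊆ : ∀ n b {x : Fin n} → x Subset.∈ initialSegment n b → toℕ x < b
  ⊆ (suc n) zero    x∈⊥       = ⊥-elim (∉⊥ x∈⊥)
  ⊆ (suc n) (suc b) here      = s≤s z≤n
  ⊆ (suc n) (suc b) (there h) = s≤s (⊆ n b h)

  ⊇ : ∀ n b {x : Fin n} → toℕ x < b → x Subset.∈ initialSegment n b
  ⊇ (suc n) (suc b) {Fin.zero}  _           = here
  ⊇ (suc n) (suc b) {Fin.suc x} (s≤s x<b) = there (⊇ n b x<b)

∣initialSegment∣≤ : ∀ n b → ∣ initialSegment n b ∣ ≤ b
∣initialSegment∣≤ zero    b       = z≤n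
∣initialSegment∣≤ (suc n) zero    = ≤-reflexive (∣⊥∣≡0 (suc n))
∣initialSegment∣≤ (suc n) (suc b) = s≤s (∣initialSegment∣≤ n b)

module ShiftSchedule (n b : ℕ) where

  i<n∸b⇒i+b<n : ∀ {i} → i < n ∸ b → i + b < n
  i<n∸b⇒i+b<n {i} i<n∸b = subst (i + b <_) (m∸n+n≡m b≤n) (+-monoˡ-< b i<n∸b)
    where
    b≤n : b ≤ n
    b≤n = <⇒≤ (m∸n≢0⇒n<m (m<n⇒n≢0 i<n∸b))

  shift : ∀ i → i < n ∸ b → Fin n × Fin n
  shift i i<n∸b = fromℕ< (≤-<-trans (m≤m+n i b) i+b<n) , fromℕ< i+b<n
    where i+b<n = i<n∸b⇒i+b<n i<n∸b

  shifts : ∀ i r → i + r ≡ n ∸ b → List (Fin n × Fin n)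
  shifts i zero    _ = []
  shifts i (suc r) e =
    shift i (subst (i <_) e (m<m+n i z<s)) ∷ shifts (suc i) r (trans (sym (+-suc i r)) e)

  ∈shifts⇒ : ∀ {i r e v w} → (v , w) ∈ₗ shifts i r e → toℕ w ≡ toℕ v + b
  ∈shifts⇒ {r = suc r} (here refl) = trans (toℕ-fromℕ< _) (cong (_+ b) (sym (toℕ-fromℕ< _)))
  ∈shifts⇒ {r = suc r} (there m)   = ∈shifts⇒ m

  ∈shifts⇐ : ∀ i r e {v w} → i ≤ toℕ v → toℕ v < i + r → toℕ w ≡ toℕ v + b →
    (v , w) ∈ₗ shifts i r e
  ∈shifts⇐ i zero e {v} i≤v v<i+0 _ =
    ⊥-elim (<⇒≱ v<i+0 (subst (_≤ toℕ v) (sym (+-identityʳ i)) i≤v))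
  ∈shifts⇐ i (suc r) e {v} i≤v v<i+r w≡v+b with m≤n⇒m<n∨m≡n i≤v
  ... | inj₁ i<v = there (∈shifts⇐ (suc i) r _ i<v (subst (toℕ v <_) (+-suc i r) v<i+r) w≡v+b)
  ... | inj₂ i≡v = here (cong₂ _,_
    (toℕ-injective (trans (sym i≡v) (sym (toℕ-fromℕ< _))))
    (toℕ-injective (trans w≡v+b (trans (cong (_+ b) (sym i≡v)) (sym (toℕ-fromℕ< _))))))

  G : Graph n
  G = emptyGraph n

  shifts-chrono : 1 ≤ b → ∀ i r e → Chrono G (Below (i + b)) (Below i) (shifts i r e)
  shifts-chrono _ i zero e = done λ (_ , w , _ , _ , w∉S , _) → w∉S (<-≤-trans (toℕ<n w) n≤i+b)
    where
    n≤i+b : n ≤ i + b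
    n≤i+b = subst (λ k → n ≤ k + b) (trans (sym e) (+-identityʳ i))
              (subst (n ≤_) (+-comm b (n ∸ b)) (m≤n+m∸n n b))
  shifts-chrono 1≤b i (suc r) e =
    step (v∈S , v∉U , w∉S , λ _ ())
         (Chrono-resp-≐ (Below-suc toℕ-w) (Below-suc toℕ-v) (shifts-chrono 1≤b (suc i) r _))
    where
    i<n∸b = subst (i <_) e (m<m+n i z<s)
    toℕ-v : toℕ (proj₁ (shift i i<n∸b)) ≡ i
    toℕ-v = toℕ-fromℕ< _
    toℕ-w : toℕ (proj₂ (shift i i<n∸b)) ≡ i + b
    toℕ-w = toℕ-fromℕ< _
    v∈S = subst (_< i + b) (sym toℕ-v) (m<m+n i 1≤b)
    v∉U = λ v<i → n≮n i (subst (_< i) toℕ-v v<i)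
    w∉S = λ w<i+b → n≮n (i + b) (subst (_< i + b) toℕ-w w<i+b)

  B : Subset n
  B = initialSegment n b

  F : List (Fin n × Fin n)
  F = shifts 0 (n ∸ b) refl

  F-covers : ∀ x → b ≤ toℕ x → ∃[ v ] ((v , x) ∈ₗ F × toℕ x ≡ toℕ v + b)
  F-covers x b≤x = v , ∈shifts⇐ 0 (n ∸ b) refl z≤n v<n∸b x≡v+b , x≡v+b
    where
    j<n∸b : toℕ x ∸ b < n ∸ b
    j<n∸b = ∸-monoˡ-< (toℕ<n x) b≤x
    v : Fin n
    v = fromℕ< (≤-<-trans (m∸n≤m (toℕ x) b) (toℕ<n x))
    v<n∸b : toℕ v < n ∸ b
    v<n∸b = subst (_< n ∸ b) (sym (toℕ-fromℕ< _)) j<n∸b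
    x≡v+b : toℕ x ≡ toℕ v + b
    x≡v+b = trans (sym (m∸n+n≡m b≤x)) (cong (_+ b) (sym (toℕ-fromℕ< _)))

  Cum⊆Below : ∀ t {x} → Cum G B F t x → toℕ x < b * suc t
  Cum⊆Below zero {x} x∈B =
    subst (toℕ x <_) (sym (*-identityʳ b)) (proj₁ (∈initialSegment≐Below n b) x∈B)
  Cum⊆Below (suc t) (inj₁ c) = <-≤-trans (Cum⊆Below t c) (*-monoʳ-≤ b (n≤1+n (suc t)))
  Cum⊆Below (suc t) {x} (inj₂ (v , m , c , _)) = begin-strict
    toℕ x             ≡⟨ ∈shifts⇒ m ⟩
    toℕ v + b         <⟨ +-monoˡ-< b (Cum⊆Below t c) ⟩
    b * suc t + b     ≡⟨ +-comm (b * suc t) b ⟩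
    b + b * suc t     ≡⟨ *-suc b (suc t) ⟨
    b * suc (suc t)   ∎
    where open ≤-Reasoning

  Below⊆Cum : ∀ t {x} → toℕ x < b * suc t → Cum G B F t x
  Below⊆Cum zero {x} x<b =
    proj₂ (∈initialSegment≐Below n b) (subst (toℕ x <_) (*-identityʳ b) x<b)
  Below⊆Cum (suc t) {x} x<b[2+t] with toℕ x <? b * suc t
  ... | yes x<b[1+t] = inj₁ (Below⊆Cum t x<b[1+t])
  ... | no  x≮b[1+t] =
    inj₂ (v , v→x , Below⊆Cum t v<b[1+t] , (λ c → x≮b[1+t] (Cum⊆Below t c)) , λ _ ())
    where
    b≤x : b ≤ toℕ x
    b≤x = ≤-trans (m≤m*n b (suc t)) (≮⇒≥ x≮b[1+t])
    cover = F-covers x b≤x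
    v = proj₁ cover
    v→x = proj₁ (proj₂ cover)
    v<b[1+t] : toℕ v < b * suc t
    v<b[1+t] = +-cancelʳ-< b (toℕ v) (b * suc t) (begin-strict
      toℕ v + b         ≡⟨ proj₂ (proj₂ cover) ⟨
      toℕ x             <⟨ x<b[2+t] ⟩
      b * suc (suc t)   ≡⟨ *-suc b (suc t) ⟩
      b + b * suc t     ≡⟨ +-comm b (b * suc t) ⟩
      b * suc t + b     ∎)
      where open ≤-Reasoning

emptyGraph-schedule : ∀ {n b} t → 1 ≤ b → n ≤ b * suc t →
  ∃[ B ] ∃[ F ] (ChronoList (emptyGraph n) B F × AllBlue (Cum (emptyGraph n) B F t) × ∣ B ∣ ≤ b)
emptyGraph-schedule {n} {b} t 1≤b n≤b[1+t] =
  B , F ,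
  Chrono-resp-≐ (swap (∈initialSegment≐Below n b)) ((λ ()) , λ ())
    (shifts-chrono 1≤b 0 (n ∸ b) refl) ,
  (λ x → Below⊆Cum t (<-≤-trans (toℕ<n x) n≤b[1+t])) ,
  ∣initialSegment∣≤ n b
  where open ShiftSchedule n b

proposition3p4 : ∀ (n : ℕ) → 1 ≤ n → ∀ (m : ℕ) → IsCeil2Sqrt-1 n m →
    IsHoppingThrottlingNumber (emptyGraph n) m
proposition3p4 n 1≤n m ceil
  with b , t , 1≤b , n≤b[1+t] , b+t≡m ← IsCeil2Sqrt-1⇒split 1≤n ceil
  with B , F , chrono , allBlue , ∣B∣≤b ← emptyGraph-schedule t 1≤b n≤b[1+t]
  = IsHoppingThrottlingNumber-intro lower
      (B , F , t , chrono , allBlue , ≤-trans (+-monoˡ-≤ t ∣B∣≤b) (≤-reflexive b+t≡m))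
  where
  lower : ∀ B F t → ChronoList (emptyGraph n) B F → AllBlue (Cum (emptyGraph n) B F t) →
    m ≤ ∣ B ∣ + t
  lower B F t chrono allBlue =
    IsCeil2Sqrt-1⇒≤ ceil ∣ B ∣ t (allBlue⇒n≤∣B∣*[1+t] t chrono allBlue)
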